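{- Let $n$ be an integer with $n \geq 0$. Then $$\sum_{0 \leq j \leq n} 2^j \binom{3n+1}{n-j} = (n+1)\binom{3n+1}{2n}\int_0^1 (3-2x)^n x^{2n}\,dx$$ and $$\sum_{0 \leq j \leq 2n} (-4)^j \binom{3n+1}{n+1+j} = \frac{1}{2}(n+1)\binom{3n+1}{2n}\int_{ -1/2}^{3/2} (3-2x)^n x^{2n}\,dx.$$ -}

module Defs where

open import Data.Nat using (ℕ; zero; suc)
open import Data.Integer using (ℤ; +_)
open import Data.Rational using (ℚ; _/_; _+_; _*_; _-_; -_; 0ℚ; 1ℚ)
open import Data.List using (List; []; _∷_)

ℕ→ℚ : ℕ → ℚ
ℕ→ℚ k = + k / 1

_^ℚ_ : ℚ → ℕ → ℚ
q ^ℚ zero = 1ℚ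
q ^ℚ suc k = q * (q ^ℚ k)

sumTo : ℕ → (ℕ → ℚ) → ℚ
sumTo zero f = f zero
sumTo (suc n) f = sumTo n f + f (suc n)

-- Polynomials with rational coefficients, as coefficient lists
-- (constant coefficient first): a₀ ∷ a₁ ∷ … represents a₀ + a₁ x + …
Poly : Set
Poly = List ℚ

_+ₚ_ : Poly → Poly → Poly
[] +ₚ q = q
(a ∷ p) +ₚ [] = a ∷ p
(a ∷ p) +ₚ (b ∷ q) = (a + b) ∷ (p +ₚ q)

scaleₚ : ℚ → Poly → Poly
scaleₚ c [] = []
scaleₚ c (a ∷ p) = (c * a) ∷ scaleₚ c p

_*ₚ_ : Poly → Poly → Poly
[] *ₚ q = []
(a ∷ p) *ₚ q = scaleₚ a q +ₚ (0ℚ ∷ (p *ₚ q))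

oneₚ : Poly
oneₚ = 1ℚ ∷ []

_^ₚ_ : Poly → ℕ → Poly
p ^ₚ zero = oneₚ
p ^ₚ suc k = p *ₚ (p ^ₚ k)

Xₚ : Poly
Xₚ = 0ℚ ∷ 1ℚ ∷ []

eval : Poly → ℚ → ℚ
eval [] x = 0ℚ
eval (a ∷ p) x = a + x * eval p x

antideriv′ : ℕ → Poly → Poly
antideriv′ k [] = []
antideriv′ k (a ∷ p) = (a * (+ 1 / suc k)) ∷ antideriv′ (suc k) p

antideriv : Poly → Poly
antideriv p = 0ℚ ∷ antideriv′ 0 p

∫[_,_]_ : ℚ → ℚ → Poly → ℚ
∫[ a , b ] p = eval (antideriv p) b - eval (antideriv p) a

integrand : ℕ → Poly
integrand n = ((ℕ→ℚ 3 ∷ (- ℕ→ℚ 2) ∷ []) ^ₚ n) *ₚ (Xₚ ^ₚ (2 Data.Nat.* n))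

-- Write y = 3/2 − x, so that (3 − 2x)ⁿ = 2ⁿ yⁿ, and N = 3n + 1. Since y′ = −1, the terms
-- C(N,k) yᵏ x^(N−k) of the binomial expansion of (y + x)^N have telescoping derivatives: the
-- partial sum over k ≤ m has derivative (N − m) C(N,m) yᵐ x^(N−m−1), and the sum over
-- m < k ≤ N has the opposite one. For m = n, (N − n) C(N,n) = (n + 1) C(N,2n), so 2ⁿ times
-- the lower sum (k ≤ n) and −2ⁿ times the upper sum (k > n) are antiderivatives of
-- (n + 1) C(N,2n) (3 − 2x)ⁿ x²ⁿ. The first identity compares the lower sum at x = 0, where it
-- vanishes, and x = 1, where y = 1/2; the second compares the upper sum at x = 3/2, where
-- y = 0, and x = −1/2, where y = 2.
-- Since ∫ is defined on coefficient lists, trading the integrand for the derivative of an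
-- antiderivative needs the identity theorem: a polynomial vanishing at every natural number
-- has only zero coefficients.

module Submission where

open import Data.Integer using (+_)
import Data.Integer as ℤ
import Data.Integer.Properties as ℤₚ
open import Data.List using ([]; _∷_; length)
open import Data.List.Relation.Unary.All using (All; []; _∷_)
open import Data.Nat using (ℕ; zero; suc; pred; _∸_; _≤_; z≤n; s≤s)
import Data.Nat as ℕ
import Data.Nat.Properties as ℕₚ
import Data.Nat.Tactic.RingSolver as ℕ-Solver
open import Data.Nat.Coprimality using (1-coprimeTo)
import Data.Nat.Coprimality as Coprime
open import Data.Nat.Combinatorics
  using (_C_; nCk+nC[k+1]≡[n+1]C[k+1]; k>n⇒nCk≡0; nC1≡n; nCk≡nC[n∸k])
open import Data.Product using (_×_; _,_; proj₁; proj₂)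
open import Data.Rational
  using (ℚ; mkℚ; _*_; _+_; _-_; -_; ½; -½; _/_; 0ℚ; 1ℚ; 1/_; ≢-nonZero)
open import Data.Rational.Properties
open import Function using (_∘_)
open import Relation.Binary.PropositionalEquality
open import Relation.Nullary using (yes; no)
open import Relation.Nullary.Decidable.Core using (dec⇒maybe)
open import Tactic.RingSolver using (solve-∀)
open import Tactic.RingSolver.Core.AlmostCommutativeRing
  using (AlmostCommutativeRing; fromCommutativeRing)

open import Defs

open ≡-Reasoning

ℚ-ring : AlmostCommutativeRing _ _
ℚ-ring = fromCommutativeRing +-*-commutativeRing (λ x → dec⇒maybe (0ℚ ≟ x))

ℕ→ℚ≡mkℚ : ∀ k → ℕ→ℚ k ≡ mkℚ (+ k) 0 (Coprime.sym (1-coprimeTo k))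
ℕ→ℚ≡mkℚ k = normalize-coprime (Coprime.sym (1-coprimeTo k))

ℕ→ℚ-suc : ∀ k → ℕ→ℚ (suc k) ≡ 1ℚ + ℕ→ℚ k
ℕ→ℚ-suc k rewrite ℕ→ℚ≡mkℚ k = /-cong (cong (ℤ._+_ (+ 1)) (sym (ℤₚ.*-identityʳ (+ k)))) refl

ℕ→ℚ-+ : ∀ a b → ℕ→ℚ (a ℕ.+ b) ≡ ℕ→ℚ a + ℕ→ℚ b
ℕ→ℚ-+ zero    b = sym (+-identityˡ (ℕ→ℚ b))
ℕ→ℚ-+ (suc a) b = begin
  ℕ→ℚ (suc (a ℕ.+ b))        ≡⟨ ℕ→ℚ-suc (a ℕ.+ b) ⟩
  1ℚ + ℕ→ℚ (a ℕ.+ b)         ≡⟨ cong (_+_ 1ℚ) (ℕ→ℚ-+ a b) ⟩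
  1ℚ + (ℕ→ℚ a + ℕ→ℚ b)       ≡⟨ sym (+-assoc 1ℚ (ℕ→ℚ a) (ℕ→ℚ b)) ⟩
  (1ℚ + ℕ→ℚ a) + ℕ→ℚ b       ≡⟨ cong (_+ ℕ→ℚ b) (sym (ℕ→ℚ-suc a)) ⟩
  ℕ→ℚ (suc a) + ℕ→ℚ b        ∎

ℕ→ℚ-* : ∀ a b → ℕ→ℚ (a ℕ.* b) ≡ ℕ→ℚ a * ℕ→ℚ b
ℕ→ℚ-* zero    b = sym (*-zeroˡ (ℕ→ℚ b))
ℕ→ℚ-* (suc a) b = begin
  ℕ→ℚ (b ℕ.+ a ℕ.* b)        ≡⟨ ℕ→ℚ-+ b (a ℕ.* b) ⟩
  ℕ→ℚ b + ℕ→ℚ (a ℕ.* b)      ≡⟨ cong (_+_ (ℕ→ℚ b)) (ℕ→ℚ-* a b) ⟩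
  ℕ→ℚ b + ℕ→ℚ a * ℕ→ℚ b      ≡⟨ distrib (ℕ→ℚ a) (ℕ→ℚ b) ⟩
  (1ℚ + ℕ→ℚ a) * ℕ→ℚ b       ≡⟨ cong (_* ℕ→ℚ b) (sym (ℕ→ℚ-suc a)) ⟩
  ℕ→ℚ (suc a) * ℕ→ℚ b        ∎
  where
  distrib : ∀ x y → y + x * y ≡ (1ℚ + x) * y
  distrib = solve-∀ ℚ-ring

ℕ→ℚ-suc≢0 : ∀ k → ℕ→ℚ (suc k) ≢ 0ℚ
ℕ→ℚ-suc≢0 k eq with trans (sym (ℕ→ℚ≡mkℚ (suc k))) eq
... | ()

ℕ→ℚ-suc*1/suc : ∀ k → ℕ→ℚ (suc k) * (+ 1 / suc k) ≡ 1ℚ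
ℕ→ℚ-suc*1/suc k
  rewrite ℕ→ℚ≡mkℚ (suc k) | normalize-coprime {1} {k} (1-coprimeTo (suc k))
  = *-inverseʳ (mkℚ (+ suc k) 0 (Coprime.sym (1-coprimeTo (suc k))))

x*y≡0⇒y≡0 : ∀ {x y} → x ≢ 0ℚ → x * y ≡ 0ℚ → y ≡ 0ℚ
x*y≡0⇒y≡0 {x} {y} x≢0 xy≡0 = begin
  y                  ≡⟨ sym (*-identityˡ y) ⟩
  1ℚ * y             ≡⟨ cong (_* y) (sym (*-inverseˡ x)) ⟩
  (1/ x * x) * y     ≡⟨ *-assoc (1/ x) x y ⟩
  1/ x * (x * y)     ≡⟨ cong (1/ x *_) xy≡0 ⟩
  1/ x * 0ℚ          ≡⟨ *-zeroʳ (1/ x) ⟩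
  0ℚ                 ∎
  where instance _ = ≢-nonZero x≢0

^ℚ-+ : ∀ q a b → q ^ℚ (a ℕ.+ b) ≡ q ^ℚ a * q ^ℚ b
^ℚ-+ q zero    b = sym (*-identityˡ (q ^ℚ b))
^ℚ-+ q (suc a) b = trans (cong (q *_) (^ℚ-+ q a b)) (sym (*-assoc q (q ^ℚ a) (q ^ℚ b)))

^ℚ-distrib-* : ∀ p q k → (p * q) ^ℚ k ≡ p ^ℚ k * q ^ℚ k
^ℚ-distrib-* p q zero    = refl
^ℚ-distrib-* p q (suc k) =
  trans (cong (p * q *_) (^ℚ-distrib-* p q k)) (interchange p q (p ^ℚ k) (q ^ℚ k))
  where
  interchange : ∀ a b c d → a * b * (c * d) ≡ a * c * (b * d)
  interchange = solve-∀ ℚ-ring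

1^ℚk≡1 : ∀ k → 1ℚ ^ℚ k ≡ 1ℚ
1^ℚk≡1 zero    = refl
1^ℚk≡1 (suc k) = trans (*-identityˡ (1ℚ ^ℚ k)) (1^ℚk≡1 k)

^ℚ-inverse : ∀ {p q} k → p * q ≡ 1ℚ → p ^ℚ k * q ^ℚ k ≡ 1ℚ
^ℚ-inverse {p} {q} k pq≡1 =
  trans (sym (^ℚ-distrib-* p q k)) (trans (cong (_^ℚ k) pq≡1) (1^ℚk≡1 k))

^ℚ-∸ : ∀ {p q} n {k} → p * q ≡ 1ℚ → k ≤ n → p ^ℚ n * q ^ℚ k ≡ p ^ℚ (n ∸ k)
^ℚ-∸ {p} {q} n {k} pq≡1 k≤n = begin
  p ^ℚ n * q ^ℚ k                      ≡⟨ cong (λ e → p ^ℚ e * q ^ℚ k) (sym (ℕₚ.m∸n+n≡m k≤n)) ⟩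
  p ^ℚ (n ∸ k ℕ.+ k) * q ^ℚ k          ≡⟨ cong (_* q ^ℚ k) (^ℚ-+ p (n ∸ k) k) ⟩
  p ^ℚ (n ∸ k) * p ^ℚ k * q ^ℚ k       ≡⟨ *-assoc (p ^ℚ (n ∸ k)) (p ^ℚ k) (q ^ℚ k) ⟩
  p ^ℚ (n ∸ k) * (p ^ℚ k * q ^ℚ k)     ≡⟨ cong (p ^ℚ (n ∸ k) *_) (^ℚ-inverse k pq≡1) ⟩
  p ^ℚ (n ∸ k) * 1ℚ                    ≡⟨ *-identityʳ (p ^ℚ (n ∸ k)) ⟩
  p ^ℚ (n ∸ k)                         ∎

^ℚ-2* : ∀ q n → q ^ℚ (2 ℕ.* n) ≡ (q * q) ^ℚ n
^ℚ-2* q n = begin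
  q ^ℚ (n ℕ.+ (n ℕ.+ 0))     ≡⟨ cong (λ e → q ^ℚ (n ℕ.+ e)) (ℕₚ.+-identityʳ n) ⟩
  q ^ℚ (n ℕ.+ n)             ≡⟨ ^ℚ-+ q n n ⟩
  q ^ℚ n * q ^ℚ n            ≡⟨ sym (^ℚ-distrib-* q q n) ⟩
  (q * q) ^ℚ n               ∎

sumTo-cong : ∀ m {f g : ℕ → ℚ} → (∀ {k} → k ≤ m → f k ≡ g k) → sumTo m f ≡ sumTo m g
sumTo-cong zero    f≗g = f≗g z≤n
sumTo-cong (suc m) f≗g = cong₂ _+_ (sumTo-cong m (f≗g ∘ ℕₚ.m≤n⇒m≤1+n)) (f≗g ℕₚ.≤-refl)

sumTo-zero : ∀ m {f : ℕ → ℚ} → (∀ {k} → k ≤ m → f k ≡ 0ℚ) → sumTo m f ≡ 0ℚ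
sumTo-zero zero    f≡0 = f≡0 z≤n
sumTo-zero (suc m) f≡0 = cong₂ _+_ (sumTo-zero m (f≡0 ∘ ℕₚ.m≤n⇒m≤1+n)) (f≡0 ℕₚ.≤-refl)

*-distribˡ-sumTo : ∀ c m (f : ℕ → ℚ) → c * sumTo m f ≡ sumTo m (λ k → c * f k)
*-distribˡ-sumTo c zero    f = refl
*-distribˡ-sumTo c (suc m) f =
  trans (*-distribˡ-+ c (sumTo m f) (f (suc m))) (cong (_+ c * f (suc m)) (*-distribˡ-sumTo c m f))

sumTo-suc : ∀ m (f : ℕ → ℚ) → sumTo (suc m) f ≡ f 0 + sumTo m (λ k → f (suc k))
sumTo-suc zero    f = refl
sumTo-suc (suc m) f = trans (cong (_+ f (suc (suc m))) (sumTo-suc m f)) (+-assoc (f 0) _ _)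

sumTo-reverse : ∀ m (f : ℕ → ℚ) → sumTo m f ≡ sumTo m (λ k → f (m ∸ k))
sumTo-reverse zero    f = refl
sumTo-reverse (suc m) f = begin
  sumTo m f + f (suc m)                          ≡⟨ +-comm (sumTo m f) (f (suc m)) ⟩
  f (suc m) + sumTo m f                          ≡⟨ cong (_+_ (f (suc m))) (sumTo-reverse m f) ⟩
  f (suc m) + sumTo m (λ k → f (m ∸ k))          ≡⟨ sym (sumTo-suc m (λ k → f (suc m ∸ k))) ⟩
  sumTo (suc m) (λ k → f (suc m ∸ k))            ∎

module _ {f g : ℕ → ℚ} (f≡Δg : ∀ k → f (suc k) ≡ g (suc k) - g k) where

  sumTo-telescope : ∀ s r → sumTo r (λ j → f (suc (s ℕ.+ j))) ≡ g (suc (s ℕ.+ r)) - g s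
  sumTo-telescope s zero    =
    trans (f≡Δg (s ℕ.+ 0)) (cong (λ i → g (suc (s ℕ.+ 0)) - g i) (ℕₚ.+-identityʳ s))
  sumTo-telescope s (suc r) = begin
    sumTo r (λ j → f (suc (s ℕ.+ j))) + f (suc (s ℕ.+ suc r))
      ≡⟨ cong₂ _+_ (sumTo-telescope s r) (f≡Δg (s ℕ.+ suc r)) ⟩
    (g (suc (s ℕ.+ r)) - g s) + (g (suc (s ℕ.+ suc r)) - g (s ℕ.+ suc r))
      ≡⟨ cong (λ i → (g i - g s) + (g (suc (s ℕ.+ suc r)) - g (s ℕ.+ suc r)))
              (sym (ℕₚ.+-suc s r)) ⟩
    (g (s ℕ.+ suc r) - g s) + (g (suc (s ℕ.+ suc r)) - g (s ℕ.+ suc r))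
      ≡⟨ cancel (g s) (g (s ℕ.+ suc r)) (g (suc (s ℕ.+ suc r))) ⟩
    g (suc (s ℕ.+ suc r)) - g s
      ∎
    where
    cancel : ∀ a b c → (b - a) + (c - b) ≡ c - a
    cancel = solve-∀ ℚ-ring

  sumTo-telescope₀ : f 0 ≡ g 0 → ∀ m → sumTo m f ≡ g m
  sumTo-telescope₀ f0≡g0 zero    = f0≡g0
  sumTo-telescope₀ f0≡g0 (suc m) = begin
    sumTo (suc m) f                      ≡⟨ sumTo-suc m f ⟩
    f 0 + sumTo m (λ k → f (suc k))      ≡⟨ cong₂ _+_ f0≡g0 (sumTo-telescope 0 m) ⟩
    g 0 + (g (suc m) - g 0)              ≡⟨ cancel (g 0) (g (suc m)) ⟩
    g (suc m)                            ∎
    where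
    cancel : ∀ a b → a + (b - a) ≡ b
    cancel = solve-∀ ℚ-ring

eval-+ₚ : ∀ p q x → eval (p +ₚ q) x ≡ eval p x + eval q x
eval-+ₚ []      q       x = sym (+-identityˡ (eval q x))
eval-+ₚ (a ∷ p) []      x = sym (+-identityʳ (a + x * eval p x))
eval-+ₚ (a ∷ p) (b ∷ q) x =
  trans (cong (λ s → a + b + x * s) (eval-+ₚ p q x)) (rearrange a b x (eval p x) (eval q x))
  where
  rearrange : ∀ a b x s t → a + b + x * (s + t) ≡ a + x * s + (b + x * t)
  rearrange = solve-∀ ℚ-ring

eval-scaleₚ : ∀ c p x → eval (scaleₚ c p) x ≡ c * eval p x
eval-scaleₚ c []      x = sym (*-zeroʳ c)
eval-scaleₚ c (a ∷ p) x =
  trans (cong (λ s → c * a + x * s) (eval-scaleₚ c p x)) (rearrange c a x (eval p x))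
  where
  rearrange : ∀ c a x s → c * a + x * (c * s) ≡ c * (a + x * s)
  rearrange = solve-∀ ℚ-ring

eval-*ₚ : ∀ p q x → eval (p *ₚ q) x ≡ eval p x * eval q x
eval-*ₚ []      q x = sym (*-zeroˡ (eval q x))
eval-*ₚ (a ∷ p) q x = begin
  eval (scaleₚ a q +ₚ (0ℚ ∷ p *ₚ q)) x
    ≡⟨ eval-+ₚ (scaleₚ a q) (0ℚ ∷ p *ₚ q) x ⟩
  eval (scaleₚ a q) x + (0ℚ + x * eval (p *ₚ q) x)
    ≡⟨ cong₂ (λ s t → s + (0ℚ + x * t)) (eval-scaleₚ a q x) (eval-*ₚ p q x) ⟩
  a * eval q x + (0ℚ + x * (eval p x * eval q x))
    ≡⟨ rearrange a x (eval p x) (eval q x) ⟩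
  (a + x * eval p x) * eval q x
    ∎
  where
  rearrange : ∀ a x s t → a * t + (0ℚ + x * (s * t)) ≡ (a + x * s) * t
  rearrange = solve-∀ ℚ-ring

eval-oneₚ : ∀ x → eval oneₚ x ≡ 1ℚ
eval-oneₚ x = trans (cong (_+_ 1ℚ) (*-zeroʳ x)) (+-identityʳ 1ℚ)

eval-^ₚ : ∀ p k x → eval (p ^ₚ k) x ≡ eval p x ^ℚ k
eval-^ₚ p zero    x = eval-oneₚ x
eval-^ₚ p (suc k) x = trans (eval-*ₚ p (p ^ₚ k) x) (cong (eval p x *_) (eval-^ₚ p k x))

eval-Xₚ : ∀ x → eval Xₚ x ≡ x
eval-Xₚ = simplify
  where
  simplify : ∀ x → 0ℚ + x * (1ℚ + x * 0ℚ) ≡ x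
  simplify = solve-∀ ℚ-ring

Σₚ : ℕ → (ℕ → Poly) → Poly
Σₚ zero    f = f zero
Σₚ (suc m) f = Σₚ m f +ₚ f (suc m)

eval-Σₚ : ∀ m f x → eval (Σₚ m f) x ≡ sumTo m (λ k → eval (f k) x)
eval-Σₚ zero    f x = refl
eval-Σₚ (suc m) f x =
  trans (eval-+ₚ (Σₚ m f) (f (suc m)) x) (cong (_+ eval (f (suc m)) x) (eval-Σₚ m f x))

-- Formal derivative

-- (a + x p)′ = p + x p′
deriv : Poly → Poly
deriv []      = []
deriv (a ∷ p) = p +ₚ (0ℚ ∷ deriv p)

eval-deriv-∷ : ∀ a p x → eval (deriv (a ∷ p)) x ≡ eval p x + x * eval (deriv p) x
eval-deriv-∷ a p x =
  trans (eval-+ₚ p (0ℚ ∷ deriv p) x) (cong (_+_ (eval p x)) (+-identityˡ _))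

eval-deriv-+ₚ : ∀ p q x → eval (deriv (p +ₚ q)) x ≡ eval (deriv p) x + eval (deriv q) x
eval-deriv-+ₚ []      q       x = sym (+-identityˡ _)
eval-deriv-+ₚ (a ∷ p) []      x = sym (+-identityʳ _)
eval-deriv-+ₚ (a ∷ p) (b ∷ q) x = begin
  eval (deriv (a + b ∷ p +ₚ q)) x
    ≡⟨ eval-deriv-∷ (a + b) (p +ₚ q) x ⟩
  eval (p +ₚ q) x + x * eval (deriv (p +ₚ q)) x
    ≡⟨ cong₂ (λ s t → s + x * t) (eval-+ₚ p q x) (eval-deriv-+ₚ p q x) ⟩
  (eval p x + eval q x) + x * (eval (deriv p) x + eval (deriv q) x)
    ≡⟨ rearrange x (eval p x) (eval q x) (eval (deriv p) x) (eval (deriv q) x) ⟩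
  (eval p x + x * eval (deriv p) x) + (eval q x + x * eval (deriv q) x)
    ≡⟨ sym (cong₂ _+_ (eval-deriv-∷ a p x) (eval-deriv-∷ b q x)) ⟩
  eval (deriv (a ∷ p)) x + eval (deriv (b ∷ q)) x
    ∎
  where
  rearrange : ∀ x s t s′ t′ → (s + t) + x * (s′ + t′) ≡ (s + x * s′) + (t + x * t′)
  rearrange = solve-∀ ℚ-ring

eval-deriv-scaleₚ : ∀ c p x → eval (deriv (scaleₚ c p)) x ≡ c * eval (deriv p) x
eval-deriv-scaleₚ c []      x = sym (*-zeroʳ c)
eval-deriv-scaleₚ c (a ∷ p) x = begin
  eval (deriv (c * a ∷ scaleₚ c p)) x
    ≡⟨ eval-deriv-∷ (c * a) (scaleₚ c p) x ⟩
  eval (scaleₚ c p) x + x * eval (deriv (scaleₚ c p)) x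
    ≡⟨ cong₂ (λ s t → s + x * t) (eval-scaleₚ c p x) (eval-deriv-scaleₚ c p x) ⟩
  c * eval p x + x * (c * eval (deriv p) x)
    ≡⟨ rearrange c x (eval p x) (eval (deriv p) x) ⟩
  c * (eval p x + x * eval (deriv p) x)
    ≡⟨ cong (c *_) (sym (eval-deriv-∷ a p x)) ⟩
  c * eval (deriv (a ∷ p)) x
    ∎
  where
  rearrange : ∀ c x s s′ → c * s + x * (c * s′) ≡ c * (s + x * s′)
  rearrange = solve-∀ ℚ-ring

eval-deriv-*ₚ : ∀ p q x →
  eval (deriv (p *ₚ q)) x ≡ eval (deriv p) x * eval q x + eval p x * eval (deriv q) x
eval-deriv-*ₚ []      q x =
  sym (trans (cong₂ _+_ (*-zeroˡ (eval q x)) (*-zeroˡ (eval (deriv q) x))) (+-identityˡ 0ℚ))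
eval-deriv-*ₚ (a ∷ p) q x = begin
  eval (deriv (scaleₚ a q +ₚ (0ℚ ∷ p *ₚ q))) x
    ≡⟨ eval-deriv-+ₚ (scaleₚ a q) (0ℚ ∷ p *ₚ q) x ⟩
  eval (deriv (scaleₚ a q)) x + eval (deriv (0ℚ ∷ p *ₚ q)) x
    ≡⟨ cong₂ _+_ (eval-deriv-scaleₚ a q x) (eval-deriv-∷ 0ℚ (p *ₚ q) x) ⟩
  a * Q′ + (eval (p *ₚ q) x + x * eval (deriv (p *ₚ q)) x)
    ≡⟨ cong₂ (λ s t → a * Q′ + (s + x * t)) (eval-*ₚ p q x) (eval-deriv-*ₚ p q x) ⟩
  a * Q′ + (P * Q + x * (P′ * Q + P * Q′))
    ≡⟨ leibniz a x P Q P′ Q′ ⟩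
  (P + x * P′) * Q + (a + x * P) * Q′
    ≡⟨ cong (λ s → s * Q + (a + x * P) * Q′) (sym (eval-deriv-∷ a p x)) ⟩
  eval (deriv (a ∷ p)) x * Q + (a + x * P) * Q′
    ∎
  where
  P = eval p x
  Q = eval q x
  P′ = eval (deriv p) x
  Q′ = eval (deriv q) x
  leibniz : ∀ a x P Q P′ Q′ →
    a * Q′ + (P * Q + x * (P′ * Q + P * Q′)) ≡ (P + x * P′) * Q + (a + x * P) * Q′
  leibniz = solve-∀ ℚ-ring

eval-deriv-^ₚ : ∀ p k x →
  eval (deriv (p ^ₚ k)) x ≡ ℕ→ℚ k * eval p x ^ℚ pred k * eval (deriv p) x
eval-deriv-^ₚ p zero x = constant x (eval (deriv p) x)
  where
  constant : ∀ x d → 0ℚ + x * 0ℚ ≡ 0ℚ * 1ℚ * d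
  constant = solve-∀ ℚ-ring
eval-deriv-^ₚ p (suc k) x = begin
  eval (deriv (p *ₚ (p ^ₚ k))) x
    ≡⟨ eval-deriv-*ₚ p (p ^ₚ k) x ⟩
  P′ * eval (p ^ₚ k) x + P * eval (deriv (p ^ₚ k)) x
    ≡⟨ cong₂ (λ s t → P′ * s + P * t) (eval-^ₚ p k x) (eval-deriv-^ₚ p k x) ⟩
  P′ * P ^ℚ k + P * (ℕ→ℚ k * P ^ℚ pred k * P′)
    ≡⟨ cong (λ t → P′ * P ^ℚ k + t) (P*P^[k-1] k) ⟩
  P′ * P ^ℚ k + ℕ→ℚ k * P ^ℚ k * P′
    ≡⟨ collect P′ (P ^ℚ k) (ℕ→ℚ k) ⟩
  (1ℚ + ℕ→ℚ k) * P ^ℚ k * P′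
    ≡⟨ cong (λ c → c * P ^ℚ k * P′) (sym (ℕ→ℚ-suc k)) ⟩
  ℕ→ℚ (suc k) * P ^ℚ k * P′
    ∎
  where
  P = eval p x
  P′ = eval (deriv p) x
  collect : ∀ d u c → d * u + c * u * d ≡ (1ℚ + c) * u * d
  collect = solve-∀ ℚ-ring
  swap : ∀ P c u d → P * (c * u * d) ≡ c * (P * u) * d
  swap = solve-∀ ℚ-ring
  annihilate : ∀ P d → P * (0ℚ * 1ℚ * d) ≡ 0ℚ * 1ℚ * d
  annihilate = solve-∀ ℚ-ring
  P*P^[k-1] : ∀ k → P * (ℕ→ℚ k * P ^ℚ pred k * P′) ≡ ℕ→ℚ k * P ^ℚ k * P′
  P*P^[k-1] zero    = annihilate P P′
  P*P^[k-1] (suc k) = swap P (ℕ→ℚ (suc k)) (P ^ℚ k) P′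

eval-deriv-Xₚ : ∀ x → eval (deriv Xₚ) x ≡ 1ℚ
eval-deriv-Xₚ = simplify
  where
  simplify : ∀ x → 1ℚ + 0ℚ + x * (0ℚ + x * 0ℚ) ≡ 1ℚ
  simplify = solve-∀ ℚ-ring

eval-Xₚ^ₚ : ∀ m x → eval (Xₚ ^ₚ m) x ≡ x ^ℚ m
eval-Xₚ^ₚ m x = trans (eval-^ₚ Xₚ m x) (cong (_^ℚ m) (eval-Xₚ x))

eval-deriv-Xₚ^ₚ : ∀ m x → eval (deriv (Xₚ ^ₚ m)) x ≡ ℕ→ℚ m * x ^ℚ pred m
eval-deriv-Xₚ^ₚ m x = begin
  eval (deriv (Xₚ ^ₚ m)) x
    ≡⟨ eval-deriv-^ₚ Xₚ m x ⟩
  ℕ→ℚ m * eval Xₚ x ^ℚ pred m * eval (deriv Xₚ) x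
    ≡⟨ cong₂ (λ s t → ℕ→ℚ m * s ^ℚ pred m * t) (eval-Xₚ x) (eval-deriv-Xₚ x) ⟩
  ℕ→ℚ m * x ^ℚ pred m * 1ℚ
    ≡⟨ *-identityʳ _ ⟩
  ℕ→ℚ m * x ^ℚ pred m
    ∎

eval-deriv-Σₚ : ∀ m f x → eval (deriv (Σₚ m f)) x ≡ sumTo m (λ k → eval (deriv (f k)) x)
eval-deriv-Σₚ zero    f x = refl
eval-deriv-Σₚ (suc m) f x = trans (eval-deriv-+ₚ (Σₚ m f) (f (suc m)) x)
  (cong (_+ eval (deriv (f (suc m))) x) (eval-deriv-Σₚ m f x))

-- Integration

antideriv′-+ₚ : ∀ k p q → antideriv′ k (p +ₚ q) ≡ antideriv′ k p +ₚ antideriv′ k q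
antideriv′-+ₚ k []      q       = refl
antideriv′-+ₚ k (a ∷ p) []      = refl
antideriv′-+ₚ k (a ∷ p) (b ∷ q) =
  cong₂ _∷_ (*-distribʳ-+ (+ 1 / suc k) a b) (antideriv′-+ₚ (suc k) p q)

antideriv′-scaleₚ : ∀ k c p → antideriv′ k (scaleₚ c p) ≡ scaleₚ c (antideriv′ k p)
antideriv′-scaleₚ k c []      = refl
antideriv′-scaleₚ k c (a ∷ p) =
  cong₂ _∷_ (*-assoc c a (+ 1 / suc k)) (antideriv′-scaleₚ (suc k) c p)

eval-antideriv′-+ₚ : ∀ k p q x →
  eval (antideriv′ k (p +ₚ q)) x ≡ eval (antideriv′ k p) x + eval (antideriv′ k q) x
eval-antideriv′-+ₚ k p q x =
  trans (cong (λ r → eval r x) (antideriv′-+ₚ k p q))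
        (eval-+ₚ (antideriv′ k p) (antideriv′ k q) x)

-- For p = Σ aᵢ xⁱ, the coefficient of xⁱ is (k + 1) aᵢ / (k + 1 + i) + i aᵢ / (k + 1 + i) = aᵢ.
antideriv′-deriv : ∀ k p x →
  ℕ→ℚ (suc k) * eval (antideriv′ k p) x + x * eval (antideriv′ (suc k) (deriv p)) x ≡ eval p x
antideriv′-deriv k []      x = vanish (ℕ→ℚ (suc k)) x
  where
  vanish : ∀ c x → c * 0ℚ + x * 0ℚ ≡ 0ℚ
  vanish = solve-∀ ℚ-ring
antideriv′-deriv k (a ∷ q) x = begin
  K * (a * w + x * A) + x * eval (antideriv′ (suc k) (q +ₚ (0ℚ ∷ deriv q))) x
    ≡⟨ cong (λ t → K * (a * w + x * A) + x * t) (eval-antideriv′-+ₚ (suc k) q (0ℚ ∷ deriv q) x) ⟩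
  K * (a * w + x * A) + x * (A + (0ℚ * w′ + x * B))
    ≡⟨ rearrange K w a x A B w′ ⟩
  a * (K * w) + x * ((1ℚ + K) * A + x * B)
    ≡⟨ cong₂ (λ s t → a * s + x * (t * A + x * B)) (ℕ→ℚ-suc*1/suc k) (sym (ℕ→ℚ-suc (suc k))) ⟩
  a * 1ℚ + x * (ℕ→ℚ (suc (suc k)) * A + x * B)
    ≡⟨ cong₂ (λ s t → s + x * t) (*-identityʳ a) (antideriv′-deriv (suc k) q x) ⟩
  a + x * eval q x
    ∎
  where
  K = ℕ→ℚ (suc k)
  w = + 1 / suc k
  w′ = + 1 / suc (suc k)
  A = eval (antideriv′ (suc k) q) x
  B = eval (antideriv′ (suc (suc k)) (deriv q)) x
  rearrange : ∀ K w a x A B w′ →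
    K * (a * w + x * A) + x * (A + (0ℚ * w′ + x * B)) ≡ a * (K * w) + x * ((1ℚ + K) * A + x * B)
  rearrange = solve-∀ ℚ-ring

eval-antideriv-deriv : ∀ p x → eval (antideriv (deriv p)) x ≡ eval p x - eval p 0ℚ
eval-antideriv-deriv []      x = constant x
  where
  constant : ∀ x → 0ℚ + x * 0ℚ ≡ 0ℚ - 0ℚ
  constant = solve-∀ ℚ-ring
eval-antideriv-deriv (a ∷ p) x = begin
  0ℚ + x * eval (antideriv′ 0 (p +ₚ (0ℚ ∷ deriv p))) x
    ≡⟨ cong (λ t → 0ℚ + x * t) (eval-antideriv′-+ₚ 0 p (0ℚ ∷ deriv p) x) ⟩
  0ℚ + x * (A + (0ℚ * 1ℚ + x * B))
    ≡⟨ rearrange x A B ⟩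
  0ℚ + x * (1ℚ * A + x * B)
    ≡⟨ cong (λ t → 0ℚ + x * t) (antideriv′-deriv 0 p x) ⟩
  0ℚ + x * eval p x
    ≡⟨ shift a x (eval p x) (eval p 0ℚ) ⟩
  (a + x * eval p x) - (a + 0ℚ * eval p 0ℚ)
    ∎
  where
  A = eval (antideriv′ 0 p) x
  B = eval (antideriv′ 1 (deriv p)) x
  rearrange : ∀ x A B → 0ℚ + x * (A + (0ℚ * 1ℚ + x * B)) ≡ 0ℚ + x * (1ℚ * A + x * B)
  rearrange = solve-∀ ℚ-ring
  shift : ∀ a x s t → 0ℚ + x * s ≡ (a + x * s) - (a + 0ℚ * t)
  shift = solve-∀ ℚ-ring

∫-deriv : ∀ p u v → ∫[ u , v ] deriv p ≡ eval p v - eval p u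
∫-deriv p u v = begin
  eval (antideriv (deriv p)) v - eval (antideriv (deriv p)) u
    ≡⟨ cong₂ _-_ (eval-antideriv-deriv p v) (eval-antideriv-deriv p u) ⟩
  (eval p v - eval p 0ℚ) - (eval p u - eval p 0ℚ)
    ≡⟨ cancel (eval p v) (eval p u) (eval p 0ℚ) ⟩
  eval p v - eval p u
    ∎
  where
  cancel : ∀ a b c → (a - c) - (b - c) ≡ a - b
  cancel = solve-∀ ℚ-ring

eval-antideriv-+ₚ : ∀ p q x →
  eval (antideriv (p +ₚ q)) x ≡ eval (antideriv p) x + eval (antideriv q) x
eval-antideriv-+ₚ p q x = begin
  0ℚ + x * eval (antideriv′ 0 (p +ₚ q)) x
    ≡⟨ cong (λ t → 0ℚ + x * t) (eval-antideriv′-+ₚ 0 p q x) ⟩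
  0ℚ + x * (eval (antideriv′ 0 p) x + eval (antideriv′ 0 q) x)
    ≡⟨ distrib x (eval (antideriv′ 0 p) x) (eval (antideriv′ 0 q) x) ⟩
  (0ℚ + x * eval (antideriv′ 0 p) x) + (0ℚ + x * eval (antideriv′ 0 q) x)
    ∎
  where
  distrib : ∀ x s t → 0ℚ + x * (s + t) ≡ (0ℚ + x * s) + (0ℚ + x * t)
  distrib = solve-∀ ℚ-ring

eval-antideriv-scaleₚ : ∀ c p x → eval (antideriv (scaleₚ c p)) x ≡ c * eval (antideriv p) x
eval-antideriv-scaleₚ c p x = begin
  0ℚ + x * eval (antideriv′ 0 (scaleₚ c p)) x
    ≡⟨ cong (λ r → 0ℚ + x * eval r x) (antideriv′-scaleₚ 0 c p) ⟩
  0ℚ + x * eval (scaleₚ c (antideriv′ 0 p)) x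
    ≡⟨ cong (λ t → 0ℚ + x * t) (eval-scaleₚ c (antideriv′ 0 p) x) ⟩
  0ℚ + x * (c * eval (antideriv′ 0 p) x)
    ≡⟨ rearrange c x (eval (antideriv′ 0 p) x) ⟩
  c * (0ℚ + x * eval (antideriv′ 0 p) x)
    ∎
  where
  rearrange : ∀ c x s → 0ℚ + x * (c * s) ≡ c * (0ℚ + x * s)
  rearrange = solve-∀ ℚ-ring

∫-+ₚ : ∀ p q u v → ∫[ u , v ] (p +ₚ q) ≡ ∫[ u , v ] p + ∫[ u , v ] q
∫-+ₚ p q u v = begin
  eval (antideriv (p +ₚ q)) v - eval (antideriv (p +ₚ q)) u
    ≡⟨ cong₂ _-_ (eval-antideriv-+ₚ p q v) (eval-antideriv-+ₚ p q u) ⟩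
  (P v + Q v) - (P u + Q u)
    ≡⟨ rearrange (P v) (Q v) (P u) (Q u) ⟩
  ∫[ u , v ] p + ∫[ u , v ] q
    ∎
  where
  P = eval (antideriv p)
  Q = eval (antideriv q)
  rearrange : ∀ a b c d → (a + b) - (c + d) ≡ (a - c) + (b - d)
  rearrange = solve-∀ ℚ-ring

∫-scaleₚ : ∀ c p u v → ∫[ u , v ] scaleₚ c p ≡ c * ∫[ u , v ] p
∫-scaleₚ c p u v = begin
  eval (antideriv (scaleₚ c p)) v - eval (antideriv (scaleₚ c p)) u
    ≡⟨ cong₂ _-_ (eval-antideriv-scaleₚ c p v) (eval-antideriv-scaleₚ c p u) ⟩
  c * eval (antideriv p) v - c * eval (antideriv p) u
    ≡⟨ factor c (eval (antideriv p) v) (eval (antideriv p) u) ⟩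
  c * ∫[ u , v ] p
    ∎
  where
  factor : ∀ c a b → c * a - c * b ≡ c * (a - b)
  factor = solve-∀ ℚ-ring

-- The identity theorem

IsZero : Poly → Set
IsZero = All (_≡ 0ℚ)

eval-IsZero : ∀ {p} → IsZero p → ∀ x → eval p x ≡ 0ℚ
eval-IsZero []                  x = refl
eval-IsZero {a ∷ p} (a≡0 ∷ p≡0) x = begin
  a + x * eval p x     ≡⟨ cong₂ (λ s t → s + x * t) a≡0 (eval-IsZero p≡0 x) ⟩
  0ℚ + x * 0ℚ          ≡⟨ cong (_+_ 0ℚ) (*-zeroʳ x) ⟩
  0ℚ                   ∎

antideriv′-IsZero : ∀ {p} k → IsZero p → IsZero (antideriv′ k p)
antideriv′-IsZero k []          = []
antideriv′-IsZero k (a≡0 ∷ p≡0) =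
  trans (cong (_* (+ 1 / suc k)) a≡0) (*-zeroˡ (+ 1 / suc k)) ∷ antideriv′-IsZero (suc k) p≡0

∫-IsZero : ∀ {p} → IsZero p → ∀ u v → ∫[ u , v ] p ≡ 0ℚ
∫-IsZero {p} p≡0 u v =
  cong₂ _-_ (eval-IsZero antideriv≡0 v) (eval-IsZero antideriv≡0 u)
  where
  antideriv≡0 : IsZero (antideriv p)
  antideriv≡0 = refl ∷ antideriv′-IsZero 0 p≡0

-- The quotient of a ∷ q by X − r, for any a.
quotient : ℚ → Poly → Poly
quotient r []      = []
quotient r (b ∷ q) = eval (b ∷ q) r ∷ quotient r q

length-quotient : ∀ r q → length (quotient r q) ≡ length q
length-quotient r []      = refl
length-quotient r (b ∷ q) = cong suc (length-quotient r q)

eval-quotient : ∀ r a q x → eval (a ∷ q) x ≡ eval (a ∷ q) r + (x - r) * eval (quotient r q) x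
eval-quotient r a []      x = constant a x r
  where
  constant : ∀ a x r → a + x * 0ℚ ≡ a + r * 0ℚ + (x - r) * 0ℚ
  constant = solve-∀ ℚ-ring
eval-quotient r a (b ∷ q) x = begin
  a + x * eval (b ∷ q) x
    ≡⟨ cong (λ t → a + x * t) (eval-quotient r b q x) ⟩
  a + x * (eval (b ∷ q) r + (x - r) * eval (quotient r q) x)
    ≡⟨ rearrange a x r (eval (b ∷ q) r) (eval (quotient r q) x) ⟩
  a + r * eval (b ∷ q) r + (x - r) * (eval (b ∷ q) r + x * eval (quotient r q) x)
    ∎
  where
  rearrange : ∀ a x r s t → a + x * (s + (x - r) * t) ≡ a + r * s + (x - r) * (s + x * t)
  rearrange = solve-∀ ℚ-ring

ℕ→ℚ-[1+m+d]-m : ∀ m d → ℕ→ℚ (suc m ℕ.+ d) - ℕ→ℚ m ≡ ℕ→ℚ (suc d)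
ℕ→ℚ-[1+m+d]-m m d = begin
  ℕ→ℚ (suc m ℕ.+ d) - ℕ→ℚ m        ≡⟨ cong (λ n → ℕ→ℚ n - ℕ→ℚ m) (sym (ℕₚ.+-suc m d)) ⟩
  ℕ→ℚ (m ℕ.+ suc d) - ℕ→ℚ m        ≡⟨ cong (_- ℕ→ℚ m) (ℕ→ℚ-+ m (suc d)) ⟩
  ℕ→ℚ m + ℕ→ℚ (suc d) - ℕ→ℚ m      ≡⟨ cancel (ℕ→ℚ m) (ℕ→ℚ (suc d)) ⟩
  ℕ→ℚ (suc d)                      ∎
  where
  cancel : ∀ a b → a + b - a ≡ b
  cancel = solve-∀ ℚ-ring

quotient-vanishing-from : ∀ m a q → (∀ d → eval (a ∷ q) (ℕ→ℚ (m ℕ.+ d)) ≡ 0ℚ) →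
  ∀ d → eval (quotient (ℕ→ℚ m) q) (ℕ→ℚ (suc m ℕ.+ d)) ≡ 0ℚ
quotient-vanishing-from m a q p≡0 d = x*y≡0⇒y≡0 x-r≢0 (begin
  (x - r) * eval (quotient r q) x            ≡⟨ sym (+-identityˡ _) ⟩
  0ℚ + (x - r) * eval (quotient r q) x       ≡⟨ cong (_+ (x - r) * eval (quotient r q) x) (sym p[r]≡0) ⟩
  eval p r + (x - r) * eval (quotient r q) x ≡⟨ sym (eval-quotient r a q x) ⟩
  eval p x                                   ≡⟨ cong (eval p ∘ ℕ→ℚ) (sym (ℕₚ.+-suc m d)) ⟩
  eval p (ℕ→ℚ (m ℕ.+ suc d))                 ≡⟨ p≡0 (suc d) ⟩
  0ℚ                                         ∎)
  where
  p = a ∷ q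
  r = ℕ→ℚ m
  x = ℕ→ℚ (suc m ℕ.+ d)
  p[r]≡0 : eval p r ≡ 0ℚ
  p[r]≡0 = trans (cong (eval p ∘ ℕ→ℚ) (sym (ℕₚ.+-identityʳ m))) (p≡0 0)
  x-r≢0 : x - r ≢ 0ℚ
  x-r≢0 x-r≡0 = ℕ→ℚ-suc≢0 d (trans (sym (ℕ→ℚ-[1+m+d]-m m d)) x-r≡0)

vanishing-∷ : ∀ a q → (∀ x → eval (a ∷ q) x ≡ 0ℚ) → a ≡ 0ℚ × (∀ {x} → x ≢ 0ℚ → eval q x ≡ 0ℚ)
vanishing-∷ a q p≡0 = a≡0 , λ {x} x≢0 → x*y≡0⇒y≡0 x≢0 (begin
  x * eval q x          ≡⟨ sym (+-identityˡ _) ⟩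
  0ℚ + x * eval q x     ≡⟨ cong (_+ x * eval q x) (sym a≡0) ⟩
  a + x * eval q x      ≡⟨ p≡0 x ⟩
  0ℚ                    ∎)
  where
  a+0*t≡a : ∀ a t → a + 0ℚ * t ≡ a
  a+0*t≡a = solve-∀ ℚ-ring
  a≡0 : a ≡ 0ℚ
  a≡0 = trans (sym (a+0*t≡a a (eval q 0ℚ))) (p≡0 0ℚ)

-- The bound L drives the induction: quotient r q is not structurally smaller than a ∷ q.
vanishing-from⇒IsZero : ∀ L p → length p ≤ L →
  ∀ m → (∀ d → eval p (ℕ→ℚ (m ℕ.+ d)) ≡ 0ℚ) → IsZero p
vanishing-from⇒IsZero L       []      _           m _   = []
vanishing-from⇒IsZero (suc L) (a ∷ q) (s≤s |q|≤L) m p≡0 =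
  proj₁ a≡0∧q≡0 ∷ vanishing-from⇒IsZero L q |q|≤L (suc m)
                     (λ d → proj₂ a≡0∧q≡0 (ℕ→ℚ-suc≢0 (m ℕ.+ d)))
  where
  r = ℕ→ℚ m
  quotient≡0 : IsZero (quotient r q)
  quotient≡0 = vanishing-from⇒IsZero L (quotient r q)
    (subst (_≤ L) (sym (length-quotient r q)) |q|≤L) (suc m) (quotient-vanishing-from m a q p≡0)
  vanish : ∀ x r → 0ℚ + (x - r) * 0ℚ ≡ 0ℚ
  vanish = solve-∀ ℚ-ring
  p≡0-everywhere : ∀ x → eval (a ∷ q) x ≡ 0ℚ
  p≡0-everywhere x = begin
    eval (a ∷ q) x
      ≡⟨ eval-quotient r a q x ⟩
    eval (a ∷ q) r + (x - r) * eval (quotient r q) x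
      ≡⟨ cong₂ (λ s t → s + (x - r) * t)
               (trans (cong (eval (a ∷ q) ∘ ℕ→ℚ) (sym (ℕₚ.+-identityʳ m))) (p≡0 0))
               (eval-IsZero quotient≡0 x) ⟩
    0ℚ + (x - r) * 0ℚ
      ≡⟨ vanish x r ⟩
    0ℚ
      ∎
  a≡0∧q≡0 = vanishing-∷ a q p≡0-everywhere

vanishing⇒IsZero : ∀ p → (∀ x → eval p x ≡ 0ℚ) → IsZero p
vanishing⇒IsZero p p≡0 = vanishing-from⇒IsZero (length p) p ℕₚ.≤-refl 0 (p≡0 ∘ ℕ→ℚ)

∫-cong : ∀ p q → (∀ x → eval p x ≡ eval q x) → ∀ u v → ∫[ u , v ] p ≡ ∫[ u , v ] q
∫-cong p q p≗q u v = begin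
  ∫[ u , v ] p
    ≡⟨ sym (cancel (∫[ u , v ] p) (∫[ u , v ] q)) ⟩
  (∫[ u , v ] p + - 1ℚ * ∫[ u , v ] q) + ∫[ u , v ] q
    ≡⟨ cong (_+ ∫[ u , v ] q) (sym ∫[p-q]≡∫p-∫q) ⟩
  ∫[ u , v ] p-q + ∫[ u , v ] q
    ≡⟨ cong (_+ ∫[ u , v ] q) (∫-IsZero (vanishing⇒IsZero p-q p-q≡0) u v) ⟩
  0ℚ + ∫[ u , v ] q
    ≡⟨ +-identityˡ _ ⟩
  ∫[ u , v ] q
    ∎
  where
  p-q = p +ₚ scaleₚ (- 1ℚ) q
  cancel : ∀ a b → (a + - 1ℚ * b) + b ≡ a
  cancel = solve-∀ ℚ-ring
  ∫[p-q]≡∫p-∫q : ∫[ u , v ] p-q ≡ ∫[ u , v ] p + - 1ℚ * ∫[ u , v ] q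
  ∫[p-q]≡∫p-∫q = trans (∫-+ₚ p (scaleₚ (- 1ℚ) q) u v) (cong (_+_ (∫[ u , v ] p)) (∫-scaleₚ (- 1ℚ) q u v))
  p-q≡0 : ∀ x → eval p-q x ≡ 0ℚ
  p-q≡0 x = begin
    eval p-q x                          ≡⟨ eval-+ₚ p (scaleₚ (- 1ℚ) q) x ⟩
    eval p x + eval (scaleₚ (- 1ℚ) q) x ≡⟨ cong₂ _+_ (p≗q x) (eval-scaleₚ (- 1ℚ) q x) ⟩
    eval q x + - 1ℚ * eval q x          ≡⟨ annihilate (eval q x) ⟩
    0ℚ                                  ∎
    where
    annihilate : ∀ a → a + - 1ℚ * a ≡ 0ℚ
    annihilate = solve-∀ ℚ-ring

∫-by-antiderivative : ∀ c p H → (∀ x → eval (deriv H) x ≡ c * eval p x) →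
  ∀ u v → c * ∫[ u , v ] p ≡ eval H v - eval H u
∫-by-antiderivative c p H H′≡cp u v = begin
  c * ∫[ u , v ] p          ≡⟨ sym (∫-scaleₚ c p u v) ⟩
  ∫[ u , v ] scaleₚ c p     ≡⟨ sym (∫-cong (deriv H) (scaleₚ c p) H′≗cp u v) ⟩
  ∫[ u , v ] deriv H        ≡⟨ ∫-deriv H u v ⟩
  eval H v - eval H u       ∎
  where
  H′≗cp : ∀ x → eval (deriv H) x ≡ eval (scaleₚ c p) x
  H′≗cp x = trans (H′≡cp x) (sym (eval-scaleₚ c p x))

-- Binomial partial sums

[k+1]*nC[k+1]≡[n∸k]*nCk : ∀ n k → suc k ℕ.* (n C suc k) ≡ (n ∸ k) ℕ.* (n C k)
[k+1]*nC[k+1]≡[n∸k]*nCk zero    k       rewrite ℕₚ.*-zeroʳ k | ℕₚ.0∸n≡0 k = refl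
[k+1]*nC[k+1]≡[n∸k]*nCk (suc n) zero    =
  trans (ℕₚ.+-identityʳ (suc n C 1)) (trans (nC1≡n (suc n)) (sym (ℕₚ.*-identityʳ (suc n))))
[k+1]*nC[k+1]≡[n∸k]*nCk (suc n) (suc k) = begin
  suc (suc k) ℕ.* (suc n C suc (suc k))
    ≡⟨ cong (suc (suc k) ℕ.*_) (sym (nCk+nC[k+1]≡[n+1]C[k+1] n (suc k))) ⟩
  suc (suc k) ℕ.* (X ℕ.+ n C suc (suc k))
    ≡⟨ ℕₚ.*-distribˡ-+ (suc (suc k)) X (n C suc (suc k)) ⟩
  suc (suc k) ℕ.* X ℕ.+ suc (suc k) ℕ.* (n C suc (suc k))
    ≡⟨ cong (suc (suc k) ℕ.* X ℕ.+_) ([k+1]*nC[k+1]≡[n∸k]*nCk n (suc k)) ⟩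
  suc (suc k) ℕ.* X ℕ.+ (n ∸ suc k) ℕ.* X
    ≡⟨ shift k (n ∸ suc k) X ⟩
  suc k ℕ.* X ℕ.+ suc (n ∸ suc k) ℕ.* X
    ≡⟨ cong (suc k ℕ.* X ℕ.+_) [1+n∸[1+k]]*X≡[n∸k]*X ⟩
  suc k ℕ.* X ℕ.+ (n ∸ k) ℕ.* X
    ≡⟨ cong (ℕ._+ (n ∸ k) ℕ.* X) ([k+1]*nC[k+1]≡[n∸k]*nCk n k) ⟩
  (n ∸ k) ℕ.* (n C k) ℕ.+ (n ∸ k) ℕ.* X
    ≡⟨ sym (ℕₚ.*-distribˡ-+ (n ∸ k) (n C k) X) ⟩
  (n ∸ k) ℕ.* (n C k ℕ.+ X)
    ≡⟨ cong ((n ∸ k) ℕ.*_) (nCk+nC[k+1]≡[n+1]C[k+1] n k) ⟩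
  (n ∸ k) ℕ.* (suc n C suc k)
    ∎
  where
  X = n C suc k
  shift : ∀ k a X → suc (suc k) ℕ.* X ℕ.+ a ℕ.* X ≡ suc k ℕ.* X ℕ.+ suc a ℕ.* X
  shift = ℕ-Solver.solve-∀
  [1+n∸[1+k]]*X≡[n∸k]*X : suc (n ∸ suc k) ℕ.* X ≡ (n ∸ k) ℕ.* X
  [1+n∸[1+k]]*X≡[n∸k]*X with k ℕₚ.<? n
  ... | yes k<n = cong (ℕ._* X) (sym (ℕₚ.+-∸-assoc 1 k<n))
  ... | no  k≮n rewrite k>n⇒nCk≡0 {n} {suc k} (s≤s (ℕₚ.≮⇒≥ k≮n))
                      | ℕₚ.*-zeroʳ (n ∸ suc k) | ℕₚ.*-zeroʳ (n ∸ k) = refl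

module BinomialPartialSums (N : ℕ) (Y : Poly) where

  binomTerm : ℕ → Poly
  binomTerm k = scaleₚ (ℕ→ℚ (N C k)) ((Y ^ₚ k) *ₚ (Xₚ ^ₚ (N ∸ k)))

  partialSum′ : ℕ → ℚ → ℚ
  partialSum′ m x = ℕ→ℚ (N C m) * ℕ→ℚ (N ∸ m) * eval Y x ^ℚ m * x ^ℚ pred (N ∸ m)

  eval-binomTerm : ∀ k x → eval (binomTerm k) x ≡ ℕ→ℚ (N C k) * (eval Y x ^ℚ k * x ^ℚ (N ∸ k))
  eval-binomTerm k x = begin
    eval (binomTerm k) x
      ≡⟨ eval-scaleₚ (ℕ→ℚ (N C k)) ((Y ^ₚ k) *ₚ (Xₚ ^ₚ (N ∸ k))) x ⟩
    ℕ→ℚ (N C k) * eval ((Y ^ₚ k) *ₚ (Xₚ ^ₚ (N ∸ k))) x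
      ≡⟨ cong (ℕ→ℚ (N C k) *_) (eval-*ₚ (Y ^ₚ k) (Xₚ ^ₚ (N ∸ k)) x) ⟩
    ℕ→ℚ (N C k) * (eval (Y ^ₚ k) x * eval (Xₚ ^ₚ (N ∸ k)) x)
      ≡⟨ cong₂ (λ s t → ℕ→ℚ (N C k) * (s * t)) (eval-^ₚ Y k x) (eval-Xₚ^ₚ (N ∸ k) x) ⟩
    ℕ→ℚ (N C k) * (eval Y x ^ℚ k * x ^ℚ (N ∸ k))
      ∎

  partialSum′-N : ∀ x → partialSum′ N x ≡ 0ℚ
  partialSum′-N x =
    trans (cong (λ d → ℕ→ℚ (N C N) * ℕ→ℚ d * eval Y x ^ℚ N * x ^ℚ pred d) (ℕₚ.n∸n≡0 N))
          (annihilate (ℕ→ℚ (N C N)) (eval Y x ^ℚ N))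
    where
    annihilate : ∀ a b → a * 0ℚ * b * 1ℚ ≡ 0ℚ
    annihilate = solve-∀ ℚ-ring

  module _ (Y′≡-1 : ∀ x → eval (deriv Y) x ≡ - 1ℚ) where

    eval-deriv-Y^k*X^m : ∀ k m x → eval (deriv ((Y ^ₚ k) *ₚ (Xₚ ^ₚ m))) x
      ≡ ℕ→ℚ m * eval Y x ^ℚ k * x ^ℚ pred m - ℕ→ℚ k * eval Y x ^ℚ pred k * x ^ℚ m
    eval-deriv-Y^k*X^m k m x = begin
      eval (deriv ((Y ^ₚ k) *ₚ (Xₚ ^ₚ m))) x
        ≡⟨ eval-deriv-*ₚ (Y ^ₚ k) (Xₚ ^ₚ m) x ⟩
      eval (deriv (Y ^ₚ k)) x * eval (Xₚ ^ₚ m) x + eval (Y ^ₚ k) x * eval (deriv (Xₚ ^ₚ m)) x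
        ≡⟨ cong₂ _+_
             (cong₂ _*_ (trans (eval-deriv-^ₚ Y k x) (cong (ℕ→ℚ k * y ^ℚ pred k *_) (Y′≡-1 x)))
                        (eval-Xₚ^ₚ m x))
             (cong₂ _*_ (eval-^ₚ Y k x) (eval-deriv-Xₚ^ₚ m x)) ⟩
      ℕ→ℚ k * y ^ℚ pred k * - 1ℚ * x ^ℚ m + y ^ℚ k * (ℕ→ℚ m * x ^ℚ pred m)
        ≡⟨ rearrange (ℕ→ℚ k) (y ^ℚ pred k) (x ^ℚ m) (y ^ℚ k) (ℕ→ℚ m) (x ^ℚ pred m) ⟩
      ℕ→ℚ m * y ^ℚ k * x ^ℚ pred m - ℕ→ℚ k * y ^ℚ pred k * x ^ℚ m
        ∎
      where
      y = eval Y x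
      rearrange : ∀ k a b c m d → k * a * - 1ℚ * b + c * (m * d) ≡ m * c * d - k * a * b
      rearrange = solve-∀ ℚ-ring

    eval-deriv-binomTerm-0 : ∀ x → eval (deriv (binomTerm 0)) x ≡ partialSum′ 0 x
    eval-deriv-binomTerm-0 x = begin
      eval (deriv (binomTerm 0)) x
        ≡⟨ eval-deriv-scaleₚ (ℕ→ℚ (N C 0)) ((Y ^ₚ 0) *ₚ (Xₚ ^ₚ N)) x ⟩
      ℕ→ℚ (N C 0) * eval (deriv ((Y ^ₚ 0) *ₚ (Xₚ ^ₚ N))) x
        ≡⟨ cong (ℕ→ℚ (N C 0) *_) (eval-deriv-Y^k*X^m 0 N x) ⟩
      ℕ→ℚ (N C 0) * (ℕ→ℚ N * 1ℚ * x ^ℚ pred N - 0ℚ * 1ℚ * x ^ℚ N)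
        ≡⟨ simplify (ℕ→ℚ (N C 0)) (ℕ→ℚ N) (x ^ℚ pred N) (x ^ℚ N) ⟩
      partialSum′ 0 x
        ∎
      where
      simplify : ∀ c n a b → c * (n * 1ℚ * a - 0ℚ * 1ℚ * b) ≡ c * n * 1ℚ * a
      simplify = solve-∀ ℚ-ring

    eval-deriv-binomTerm-suc : ∀ k x →
      eval (deriv (binomTerm (suc k))) x ≡ partialSum′ (suc k) x - partialSum′ k x
    eval-deriv-binomTerm-suc k x = begin
      eval (deriv (binomTerm (suc k))) x
        ≡⟨ eval-deriv-scaleₚ c ((Y ^ₚ suc k) *ₚ (Xₚ ^ₚ m)) x ⟩
      c * eval (deriv ((Y ^ₚ suc k) *ₚ (Xₚ ^ₚ m))) x
        ≡⟨ cong (c *_) (eval-deriv-Y^k*X^m (suc k) m x) ⟩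
      c * (ℕ→ℚ m * y ^ℚ suc k * x ^ℚ pred m - ℕ→ℚ (suc k) * y ^ℚ k * x ^ℚ m)
        ≡⟨ distrib c (ℕ→ℚ m) (y ^ℚ suc k) (x ^ℚ pred m) (ℕ→ℚ (suc k)) (y ^ℚ k) (x ^ℚ m) ⟩
      partialSum′ (suc k) x - c * ℕ→ℚ (suc k) * y ^ℚ k * x ^ℚ m
        ≡⟨ cong₂ (λ a e → partialSum′ (suc k) x - a * y ^ℚ k * x ^ℚ e)
             absorption (sym (ℕₚ.pred[m∸n]≡m∸[1+n] N k)) ⟩
      partialSum′ (suc k) x - partialSum′ k x
        ∎
      where
      c = ℕ→ℚ (N C suc k)
      m = N ∸ suc k
      y = eval Y x
      distrib : ∀ c m a b k d e → c * (m * a * b - k * d * e) ≡ c * m * a * b - c * k * d * e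
      distrib = solve-∀ ℚ-ring
      absorption : ℕ→ℚ (N C suc k) * ℕ→ℚ (suc k) ≡ ℕ→ℚ (N C k) * ℕ→ℚ (N ∸ k)
      absorption = begin
        ℕ→ℚ (N C suc k) * ℕ→ℚ (suc k)      ≡⟨ sym (ℕ→ℚ-* (N C suc k) (suc k)) ⟩
        ℕ→ℚ ((N C suc k) ℕ.* suc k)        ≡⟨ cong ℕ→ℚ (ℕₚ.*-comm (N C suc k) (suc k)) ⟩
        ℕ→ℚ (suc k ℕ.* (N C suc k))        ≡⟨ cong ℕ→ℚ ([k+1]*nC[k+1]≡[n∸k]*nCk N k) ⟩
        ℕ→ℚ ((N ∸ k) ℕ.* (N C k))          ≡⟨ cong ℕ→ℚ (ℕₚ.*-comm (N ∸ k) (N C k)) ⟩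
        ℕ→ℚ ((N C k) ℕ.* (N ∸ k))          ≡⟨ ℕ→ℚ-* (N C k) (N ∸ k) ⟩
        ℕ→ℚ (N C k) * ℕ→ℚ (N ∸ k)          ∎

    eval-deriv-Σₚ-binomTerm : ∀ m x → eval (deriv (Σₚ m binomTerm)) x ≡ partialSum′ m x
    eval-deriv-Σₚ-binomTerm m x =
      trans (eval-deriv-Σₚ m binomTerm x)
            (sumTo-telescope₀ {f = λ k → eval (deriv (binomTerm k)) x} {g = λ k → partialSum′ k x}
                              (λ k → eval-deriv-binomTerm-suc k x) (eval-deriv-binomTerm-0 x) m)

    eval-deriv-Σₚ-binomTerm-tail : ∀ s r x →
      eval (deriv (Σₚ r (λ j → binomTerm (suc (s ℕ.+ j))))) x
        ≡ partialSum′ (suc (s ℕ.+ r)) x - partialSum′ s x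
    eval-deriv-Σₚ-binomTerm-tail s r x =
      trans (eval-deriv-Σₚ r (λ j → binomTerm (suc (s ℕ.+ j))) x)
            (sumTo-telescope {f = λ k → eval (deriv (binomTerm k)) x} {g = λ k → partialSum′ k x}
                             (λ k → eval-deriv-binomTerm-suc k x) s r)

-- The case y = 3/2 − x, N = 3n + 1

3/2-X : Poly
3/2-X = + 3 / 2 ∷ - 1ℚ ∷ []

eval-deriv-3/2-X : ∀ x → eval (deriv 3/2-X) x ≡ - 1ℚ
eval-deriv-3/2-X = simplify
  where
  simplify : ∀ x → - 1ℚ + 0ℚ + x * (0ℚ + x * 0ℚ) ≡ - 1ℚ
  simplify = solve-∀ ℚ-ring

eval-integrand : ∀ n x → eval (integrand n) x ≡ ℕ→ℚ 2 ^ℚ n * (eval 3/2-X x ^ℚ n * x ^ℚ (2 ℕ.* n))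
eval-integrand n x = begin
  eval (integrand n) x
    ≡⟨ eval-*ₚ (U ^ₚ n) (Xₚ ^ₚ (2 ℕ.* n)) x ⟩
  eval (U ^ₚ n) x * eval (Xₚ ^ₚ (2 ℕ.* n)) x
    ≡⟨ cong₂ _*_ (eval-^ₚ U n x) (eval-Xₚ^ₚ (2 ℕ.* n) x) ⟩
  eval U x ^ℚ n * x ^ℚ (2 ℕ.* n)
    ≡⟨ cong (λ u → u ^ℚ n * x ^ℚ (2 ℕ.* n)) (U≡2*[3/2-X] x) ⟩
  (ℕ→ℚ 2 * eval 3/2-X x) ^ℚ n * x ^ℚ (2 ℕ.* n)
    ≡⟨ cong (_* x ^ℚ (2 ℕ.* n)) (^ℚ-distrib-* (ℕ→ℚ 2) (eval 3/2-X x) n) ⟩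
  ℕ→ℚ 2 ^ℚ n * eval 3/2-X x ^ℚ n * x ^ℚ (2 ℕ.* n)
    ≡⟨ *-assoc (ℕ→ℚ 2 ^ℚ n) (eval 3/2-X x ^ℚ n) (x ^ℚ (2 ℕ.* n)) ⟩
  ℕ→ℚ 2 ^ℚ n * (eval 3/2-X x ^ℚ n * x ^ℚ (2 ℕ.* n))
    ∎
  where
  U = ℕ→ℚ 3 ∷ - ℕ→ℚ 2 ∷ []
  U≡2*[3/2-X] : ∀ x → ℕ→ℚ 3 + x * (- ℕ→ℚ 2 + x * 0ℚ) ≡ ℕ→ℚ 2 * (+ 3 / 2 + x * (- 1ℚ + x * 0ℚ))
  U≡2*[3/2-X] = solve-∀ ℚ-ring

2^n*2^[1+n+j]*[-½]^[2n∸j] : ∀ n j → j ≤ 2 ℕ.* n →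
  ℕ→ℚ 2 ^ℚ n * (ℕ→ℚ 2 ^ℚ suc (n ℕ.+ j) * -½ ^ℚ (2 ℕ.* n ∸ j)) ≡ ℕ→ℚ 2 * (- ℕ→ℚ 4) ^ℚ j
2^n*2^[1+n+j]*[-½]^[2n∸j] n j j≤2n = begin
  two ^ℚ n * (two * two ^ℚ (n ℕ.+ j) * -½ ^ℚ a)
    ≡⟨ cong (λ t → two ^ℚ n * (two * t * -½ ^ℚ a)) (^ℚ-+ two n j) ⟩
  two ^ℚ n * (two * (two ^ℚ n * two ^ℚ j) * -½ ^ℚ a)
    ≡⟨ rearrange two (two ^ℚ n) (two ^ℚ j) (-½ ^ℚ a) ⟩
  two * (two ^ℚ n * two ^ℚ n) * two ^ℚ j * -½ ^ℚ a
    ≡⟨ cong (λ t → two * t * two ^ℚ j * -½ ^ℚ a) 2^n*2^n≡[-2]^2n ⟩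
  two * (- two) ^ℚ (2 ℕ.* n) * two ^ℚ j * -½ ^ℚ a
    ≡⟨ cong (λ e → two * (- two) ^ℚ e * two ^ℚ j * -½ ^ℚ a) (sym (ℕₚ.m+[n∸m]≡n j≤2n)) ⟩
  two * (- two) ^ℚ (j ℕ.+ a) * two ^ℚ j * -½ ^ℚ a
    ≡⟨ cong (λ t → two * t * two ^ℚ j * -½ ^ℚ a) (^ℚ-+ (- two) j a) ⟩
  two * ((- two) ^ℚ j * (- two) ^ℚ a) * two ^ℚ j * -½ ^ℚ a
    ≡⟨ regroup two ((- two) ^ℚ j) ((- two) ^ℚ a) (two ^ℚ j) (-½ ^ℚ a) ⟩
  two * ((- two) ^ℚ j * two ^ℚ j) * ((- two) ^ℚ a * -½ ^ℚ a)
    ≡⟨ cong₂ (λ s t → two * s * t) (sym (^ℚ-distrib-* (- two) two j)) (^ℚ-inverse a refl) ⟩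
  two * (- two * two) ^ℚ j * 1ℚ
    ≡⟨ *-identityʳ _ ⟩
  two * (- ℕ→ℚ 4) ^ℚ j
    ∎
  where
  two = ℕ→ℚ 2
  a = 2 ℕ.* n ∸ j
  2^n*2^n≡[-2]^2n : two ^ℚ n * two ^ℚ n ≡ (- two) ^ℚ (2 ℕ.* n)
  2^n*2^n≡[-2]^2n = trans (sym (^ℚ-distrib-* two two n)) (sym (^ℚ-2* (- two) n))
  rearrange : ∀ t p q r → p * (t * (p * q) * r) ≡ t * (p * p) * q * r
  rearrange = solve-∀ ℚ-ring
  regroup : ∀ t s u q r → t * (s * u) * q * r ≡ t * (s * q) * (u * r)
  regroup = solve-∀ ℚ-ring

module _ (n : ℕ) where

  private
    N = 3 ℕ.* n ℕ.+ 1
    two^ : ℕ → ℚ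
    two^ k = ℕ→ℚ 2 ^ℚ k

  open BinomialPartialSums N 3/2-X

  N≡1+n+2n : N ≡ suc (n ℕ.+ 2 ℕ.* n)
  N≡1+n+2n = ℕₚ.+-comm (3 ℕ.* n) 1

  N∸n≡1+2n : N ∸ n ≡ suc (2 ℕ.* n)
  N∸n≡1+2n = begin
    N ∸ n                        ≡⟨ cong (_∸ n) N≡1+n+2n ⟩
    suc (n ℕ.+ 2 ℕ.* n) ∸ n      ≡⟨ cong (_∸ n) (sym (ℕₚ.+-suc n (2 ℕ.* n))) ⟩
    n ℕ.+ suc (2 ℕ.* n) ∸ n      ≡⟨ ℕₚ.m+n∸m≡n n (suc (2 ℕ.* n)) ⟩
    suc (2 ℕ.* n)                ∎

  N∸k≡1+[n+2n∸k] : ∀ {k} → k ≤ n → N ∸ k ≡ suc (n ℕ.+ 2 ℕ.* n ∸ k)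
  N∸k≡1+[n+2n∸k] {k} k≤n =
    trans (cong (_∸ k) N≡1+n+2n) (ℕₚ.+-∸-assoc 1 (ℕₚ.m≤n⇒m≤n+o (2 ℕ.* n) k≤n))

  N∸[1+n]≡2n : N ∸ suc n ≡ 2 ℕ.* n
  N∸[1+n]≡2n = trans (cong (_∸ suc n) N≡1+n+2n) (ℕₚ.m+n∸m≡n n (2 ℕ.* n))

  N∸[1+n+j]≡2n∸j : ∀ j → N ∸ suc (n ℕ.+ j) ≡ 2 ℕ.* n ∸ j
  N∸[1+n+j]≡2n∸j j = trans (cong (_∸ suc (n ℕ.+ j)) N≡1+n+2n) (ℕₚ.[m+n]∸[m+o]≡n∸o n (2 ℕ.* n) j)

  [1+2n]*NCn≡[1+n]*NC2n : suc (2 ℕ.* n) ℕ.* (N C n) ≡ suc n ℕ.* (N C (2 ℕ.* n))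
  [1+2n]*NCn≡[1+n]*NC2n = begin
    suc (2 ℕ.* n) ℕ.* (N C n)         ≡⟨ cong (ℕ._* (N C n)) (sym N∸n≡1+2n) ⟩
    (N ∸ n) ℕ.* (N C n)               ≡⟨ sym ([k+1]*nC[k+1]≡[n∸k]*nCk N n) ⟩
    suc n ℕ.* (N C suc n)             ≡⟨ cong (suc n ℕ.*_) (nCk≡nC[n∸k] 1+n≤N) ⟩
    suc n ℕ.* (N C (N ∸ suc n))       ≡⟨ cong (λ k → suc n ℕ.* (N C k)) N∸[1+n]≡2n ⟩
    suc n ℕ.* (N C (2 ℕ.* n))         ∎
    where
    1+n≤N : suc n ≤ N
    1+n≤N = subst (suc n ≤_) (sym N≡1+n+2n) (s≤s (ℕₚ.m≤m+n n (2 ℕ.* n)))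

  K : ℚ
  K = ℕ→ℚ (suc n) * ℕ→ℚ (N C (2 ℕ.* n))

  2^n*partialSum′≡K*integrand : ∀ x → two^ n * partialSum′ n x ≡ K * eval (integrand n) x
  2^n*partialSum′≡K*integrand x = begin
    two^ n * (c * ℕ→ℚ (N ∸ n) * y ^ℚ n * x ^ℚ pred (N ∸ n))
      ≡⟨ cong (λ d → two^ n * (c * ℕ→ℚ d * y ^ℚ n * x ^ℚ pred d)) N∸n≡1+2n ⟩
    two^ n * (c * ℕ→ℚ (suc (2 ℕ.* n)) * y ^ℚ n * x ^ℚ (2 ℕ.* n))
      ≡⟨ rearrange (two^ n) c (ℕ→ℚ (suc (2 ℕ.* n))) (y ^ℚ n) (x ^ℚ (2 ℕ.* n)) ⟩
    c * ℕ→ℚ (suc (2 ℕ.* n)) * (two^ n * (y ^ℚ n * x ^ℚ (2 ℕ.* n)))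
      ≡⟨ cong₂ _*_ c*[1+2n]≡K (sym (eval-integrand n x)) ⟩
    K * eval (integrand n) x
      ∎
    where
    c = ℕ→ℚ (N C n)
    y = eval 3/2-X x
    rearrange : ∀ t c d u v → t * (c * d * u * v) ≡ c * d * (t * (u * v))
    rearrange = solve-∀ ℚ-ring
    c*[1+2n]≡K : c * ℕ→ℚ (suc (2 ℕ.* n)) ≡ K
    c*[1+2n]≡K = begin
      ℕ→ℚ (N C n) * ℕ→ℚ (suc (2 ℕ.* n))       ≡⟨ *-comm (ℕ→ℚ (N C n)) (ℕ→ℚ (suc (2 ℕ.* n))) ⟩
      ℕ→ℚ (suc (2 ℕ.* n)) * ℕ→ℚ (N C n)       ≡⟨ sym (ℕ→ℚ-* (suc (2 ℕ.* n)) (N C n)) ⟩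
      ℕ→ℚ (suc (2 ℕ.* n) ℕ.* (N C n))         ≡⟨ cong ℕ→ℚ [1+2n]*NCn≡[1+n]*NC2n ⟩
      ℕ→ℚ (suc n ℕ.* (N C (2 ℕ.* n)))         ≡⟨ ℕ→ℚ-* (suc n) (N C (2 ℕ.* n)) ⟩
      K                                       ∎

  lowerSum : Poly
  lowerSum = Σₚ n binomTerm

  upperSum : Poly
  upperSum = Σₚ (2 ℕ.* n) (λ j → binomTerm (suc (n ℕ.+ j)))

  eval-deriv-lowerSum : ∀ x → eval (deriv (scaleₚ (two^ n) lowerSum)) x ≡ K * eval (integrand n) x
  eval-deriv-lowerSum x = begin
    eval (deriv (scaleₚ (two^ n) lowerSum)) x  ≡⟨ eval-deriv-scaleₚ (two^ n) lowerSum x ⟩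
    two^ n * eval (deriv lowerSum) x           ≡⟨ cong (two^ n *_) (eval-deriv-Σₚ-binomTerm eval-deriv-3/2-X n x) ⟩
    two^ n * partialSum′ n x                   ≡⟨ 2^n*partialSum′≡K*integrand x ⟩
    K * eval (integrand n) x                   ∎

  eval-deriv-upperSum : ∀ x → eval (deriv (scaleₚ (- two^ n) upperSum)) x ≡ K * eval (integrand n) x
  eval-deriv-upperSum x = begin
    eval (deriv (scaleₚ (- two^ n) upperSum)) x
      ≡⟨ eval-deriv-scaleₚ (- two^ n) upperSum x ⟩
    - two^ n * eval (deriv upperSum) x
      ≡⟨ cong (- two^ n *_) (eval-deriv-Σₚ-binomTerm-tail eval-deriv-3/2-X n (2 ℕ.* n) x) ⟩
    - two^ n * (partialSum′ (suc (n ℕ.+ 2 ℕ.* n)) x - partialSum′ n x)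
      ≡⟨ cong (λ m → - two^ n * (partialSum′ m x - partialSum′ n x)) (sym N≡1+n+2n) ⟩
    - two^ n * (partialSum′ N x - partialSum′ n x)
      ≡⟨ cong (λ s → - two^ n * (s - partialSum′ n x)) (partialSum′-N x) ⟩
    - two^ n * (0ℚ - partialSum′ n x)
      ≡⟨ negate (two^ n) (partialSum′ n x) ⟩
    two^ n * partialSum′ n x
      ≡⟨ 2^n*partialSum′≡K*integrand x ⟩
    K * eval (integrand n) x
      ∎
    where
    negate : ∀ c s → - c * (0ℚ - s) ≡ c * s
    negate = solve-∀ ℚ-ring

  lowerSum-at-0 : eval lowerSum 0ℚ ≡ 0ℚ
  lowerSum-at-0 = trans (eval-Σₚ n binomTerm 0ℚ) (sumTo-zero n term-at-0)
    where
    annihilate : ∀ c a b → c * (a * (0ℚ * b)) ≡ 0ℚ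
    annihilate = solve-∀ ℚ-ring
    term-at-0 : ∀ {k} → k ≤ n → eval (binomTerm k) 0ℚ ≡ 0ℚ
    term-at-0 {k} k≤n = begin
      eval (binomTerm k) 0ℚ
        ≡⟨ eval-binomTerm k 0ℚ ⟩
      ℕ→ℚ (N C k) * (eval 3/2-X 0ℚ ^ℚ k * 0ℚ ^ℚ (N ∸ k))
        ≡⟨ cong (λ e → ℕ→ℚ (N C k) * (eval 3/2-X 0ℚ ^ℚ k * 0ℚ ^ℚ e)) (N∸k≡1+[n+2n∸k] k≤n) ⟩
      ℕ→ℚ (N C k) * (eval 3/2-X 0ℚ ^ℚ k * (0ℚ * 0ℚ ^ℚ (n ℕ.+ 2 ℕ.* n ∸ k)))
        ≡⟨ annihilate (ℕ→ℚ (N C k)) (eval 3/2-X 0ℚ ^ℚ k) (0ℚ ^ℚ (n ℕ.+ 2 ℕ.* n ∸ k)) ⟩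
      0ℚ
        ∎

  2^n*lowerSum-at-1 : two^ n * eval lowerSum 1ℚ ≡ sumTo n (λ j → two^ j * ℕ→ℚ (N C (n ∸ j)))
  2^n*lowerSum-at-1 = begin
    two^ n * eval lowerSum 1ℚ
      ≡⟨ cong (two^ n *_) (eval-Σₚ n binomTerm 1ℚ) ⟩
    two^ n * sumTo n (λ k → eval (binomTerm k) 1ℚ)
      ≡⟨ *-distribˡ-sumTo (two^ n) n (λ k → eval (binomTerm k) 1ℚ) ⟩
    sumTo n (λ k → two^ n * eval (binomTerm k) 1ℚ)
      ≡⟨ sumTo-cong n term-at-1 ⟩
    sumTo n (λ k → two^ (n ∸ k) * ℕ→ℚ (N C (n ∸ (n ∸ k))))
      ≡⟨ sym (sumTo-reverse n (λ j → two^ j * ℕ→ℚ (N C (n ∸ j)))) ⟩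
    sumTo n (λ j → two^ j * ℕ→ℚ (N C (n ∸ j)))
      ∎
    where
    rearrange : ∀ t c h → t * (c * (h * 1ℚ)) ≡ t * h * c
    rearrange = solve-∀ ℚ-ring
    term-at-1 : ∀ {k} → k ≤ n → two^ n * eval (binomTerm k) 1ℚ ≡ two^ (n ∸ k) * ℕ→ℚ (N C (n ∸ (n ∸ k)))
    term-at-1 {k} k≤n = begin
      two^ n * eval (binomTerm k) 1ℚ
        ≡⟨ cong (two^ n *_) (eval-binomTerm k 1ℚ) ⟩
      two^ n * (ℕ→ℚ (N C k) * (½ ^ℚ k * 1ℚ ^ℚ (N ∸ k)))
        ≡⟨ cong (λ t → two^ n * (ℕ→ℚ (N C k) * (½ ^ℚ k * t))) (1^ℚk≡1 (N ∸ k)) ⟩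
      two^ n * (ℕ→ℚ (N C k) * (½ ^ℚ k * 1ℚ))
        ≡⟨ rearrange (two^ n) (ℕ→ℚ (N C k)) (½ ^ℚ k) ⟩
      two^ n * ½ ^ℚ k * ℕ→ℚ (N C k)
        ≡⟨ cong₂ (λ t i → t * ℕ→ℚ (N C i)) (^ℚ-∸ n refl k≤n) (sym (ℕₚ.m∸[m∸n]≡n k≤n)) ⟩
      two^ (n ∸ k) * ℕ→ℚ (N C (n ∸ (n ∸ k)))
        ∎

  upperSum-at-3/2 : eval upperSum (+ 3 / 2) ≡ 0ℚ
  upperSum-at-3/2 = trans (eval-Σₚ (2 ℕ.* n) _ (+ 3 / 2)) (sumTo-zero (2 ℕ.* n) λ {j} _ →
    let k = suc (n ℕ.+ j) in
    trans (eval-binomTerm k (+ 3 / 2))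
          (annihilate (ℕ→ℚ (N C k)) (0ℚ ^ℚ (n ℕ.+ j)) ((+ 3 / 2) ^ℚ (N ∸ k))))
    where
    annihilate : ∀ c a b → c * (0ℚ * a * b) ≡ 0ℚ
    annihilate = solve-∀ ℚ-ring

  2^n*upperSum-at--½ : two^ n * eval upperSum -½
    ≡ ℕ→ℚ 2 * sumTo (2 ℕ.* n) (λ j → (- ℕ→ℚ 4) ^ℚ j * ℕ→ℚ (N C (n ℕ.+ 1 ℕ.+ j)))
  2^n*upperSum-at--½ = begin
    two^ n * eval upperSum -½
      ≡⟨ cong (two^ n *_) (eval-Σₚ (2 ℕ.* n) (λ j → binomTerm (suc (n ℕ.+ j))) -½) ⟩
    two^ n * sumTo (2 ℕ.* n) (λ j → eval (binomTerm (suc (n ℕ.+ j))) -½)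
      ≡⟨ *-distribˡ-sumTo (two^ n) (2 ℕ.* n) _ ⟩
    sumTo (2 ℕ.* n) (λ j → two^ n * eval (binomTerm (suc (n ℕ.+ j))) -½)
      ≡⟨ sumTo-cong (2 ℕ.* n) term-at--½ ⟩
    sumTo (2 ℕ.* n) (λ j → ℕ→ℚ 2 * ((- ℕ→ℚ 4) ^ℚ j * ℕ→ℚ (N C (n ℕ.+ 1 ℕ.+ j))))
      ≡⟨ sym (*-distribˡ-sumTo (ℕ→ℚ 2) (2 ℕ.* n) _) ⟩
    ℕ→ℚ 2 * sumTo (2 ℕ.* n) (λ j → (- ℕ→ℚ 4) ^ℚ j * ℕ→ℚ (N C (n ℕ.+ 1 ℕ.+ j)))
      ∎
    where
    rearrange : ∀ t c u v → t * (c * (u * v)) ≡ t * (u * v) * c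
    rearrange = solve-∀ ℚ-ring
    term-at--½ : ∀ {j} → j ≤ 2 ℕ.* n → two^ n * eval (binomTerm (suc (n ℕ.+ j))) -½
      ≡ ℕ→ℚ 2 * ((- ℕ→ℚ 4) ^ℚ j * ℕ→ℚ (N C (n ℕ.+ 1 ℕ.+ j)))
    term-at--½ {j} j≤2n = begin
      two^ n * eval (binomTerm k) -½
        ≡⟨ cong (two^ n *_) (eval-binomTerm k -½) ⟩
      two^ n * (c * (two^ k * -½ ^ℚ (N ∸ k)))
        ≡⟨ cong (λ e → two^ n * (c * (two^ k * -½ ^ℚ e))) (N∸[1+n+j]≡2n∸j j) ⟩
      two^ n * (c * (two^ k * -½ ^ℚ (2 ℕ.* n ∸ j)))
        ≡⟨ rearrange (two^ n) c (two^ k) (-½ ^ℚ (2 ℕ.* n ∸ j)) ⟩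
      two^ n * (two^ k * -½ ^ℚ (2 ℕ.* n ∸ j)) * c
        ≡⟨ cong₂ _*_ (2^n*2^[1+n+j]*[-½]^[2n∸j] n j j≤2n)
                     (cong (λ i → ℕ→ℚ (N C i)) (sym (cong (ℕ._+ j) (ℕₚ.+-comm n 1)))) ⟩
      ℕ→ℚ 2 * (- ℕ→ℚ 4) ^ℚ j * ℕ→ℚ (N C (n ℕ.+ 1 ℕ.+ j))
        ≡⟨ *-assoc (ℕ→ℚ 2) ((- ℕ→ℚ 4) ^ℚ j) (ℕ→ℚ (N C (n ℕ.+ 1 ℕ.+ j))) ⟩
      ℕ→ℚ 2 * ((- ℕ→ℚ 4) ^ℚ j * ℕ→ℚ (N C (n ℕ.+ 1 ℕ.+ j)))
        ∎
      where
      k = suc (n ℕ.+ j)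
      c = ℕ→ℚ (N C k)

  first-identity : sumTo n (λ j → two^ j * ℕ→ℚ (N C (n ∸ j))) ≡ K * ∫[ 0ℚ , 1ℚ ] integrand n
  first-identity = begin
    sumTo n (λ j → two^ j * ℕ→ℚ (N C (n ∸ j)))
      ≡⟨ sym 2^n*lowerSum-at-1 ⟩
    two^ n * eval lowerSum 1ℚ
      ≡⟨ sym (drop (two^ n * eval lowerSum 1ℚ) (two^ n)) ⟩
    two^ n * eval lowerSum 1ℚ - two^ n * 0ℚ
      ≡⟨ cong (λ s → two^ n * eval lowerSum 1ℚ - two^ n * s) (sym lowerSum-at-0) ⟩
    two^ n * eval lowerSum 1ℚ - two^ n * eval lowerSum 0ℚ
      ≡⟨ sym (cong₂ _-_ (eval-scaleₚ (two^ n) lowerSum 1ℚ) (eval-scaleₚ (two^ n) lowerSum 0ℚ)) ⟩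
    eval H 1ℚ - eval H 0ℚ
      ≡⟨ sym (∫-by-antiderivative K (integrand n) H eval-deriv-lowerSum 0ℚ 1ℚ) ⟩
    K * ∫[ 0ℚ , 1ℚ ] integrand n
      ∎
    where
    H = scaleₚ (two^ n) lowerSum
    drop : ∀ a c → a - c * 0ℚ ≡ a
    drop = solve-∀ ℚ-ring

  second-identity :
    sumTo (2 ℕ.* n) (λ j → (- ℕ→ℚ 4) ^ℚ j * ℕ→ℚ (N C (n ℕ.+ 1 ℕ.+ j)))
      ≡ ½ * ℕ→ℚ (suc n) * ℕ→ℚ (N C (2 ℕ.* n)) * ∫[ -½ , + 3 / 2 ] integrand n
  second-identity = begin
    L
      ≡⟨ sym (½*[2*a]≡a L) ⟩
    ½ * (ℕ→ℚ 2 * L)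
      ≡⟨ cong (½ *_) (sym 2^n*upperSum-at--½) ⟩
    ½ * (two^ n * eval upperSum -½)
      ≡⟨ cong (½ *_) (flip-sign (two^ n) (eval upperSum -½)) ⟩
    ½ * (- two^ n * 0ℚ - - two^ n * eval upperSum -½)
      ≡⟨ cong (½ *_) (sym (cong₂ _-_ (trans (eval-scaleₚ (- two^ n) upperSum (+ 3 / 2))
                                            (cong (- two^ n *_) upperSum-at-3/2))
                                     (eval-scaleₚ (- two^ n) upperSum -½))) ⟩
    ½ * (eval H (+ 3 / 2) - eval H -½)
      ≡⟨ cong (½ *_) (sym (∫-by-antiderivative K (integrand n) H eval-deriv-upperSum -½ (+ 3 / 2))) ⟩
    ½ * (K * ∫[ -½ , + 3 / 2 ] integrand n)
      ≡⟨ reassociate ½ (ℕ→ℚ (suc n)) (ℕ→ℚ (N C (2 ℕ.* n))) (∫[ -½ , + 3 / 2 ] integrand n) ⟩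
    ½ * ℕ→ℚ (suc n) * ℕ→ℚ (N C (2 ℕ.* n)) * ∫[ -½ , + 3 / 2 ] integrand n
      ∎
    where
    L = sumTo (2 ℕ.* n) (λ j → (- ℕ→ℚ 4) ^ℚ j * ℕ→ℚ (N C (n ℕ.+ 1 ℕ.+ j)))
    H = scaleₚ (- two^ n) upperSum
    ½*[2*a]≡a : ∀ a → ½ * (ℕ→ℚ 2 * a) ≡ a
    ½*[2*a]≡a = solve-∀ ℚ-ring
    flip-sign : ∀ c t → c * t ≡ - c * 0ℚ - - c * t
    flip-sign = solve-∀ ℚ-ring
    reassociate : ∀ h a b i → h * (a * b * i) ≡ h * a * b * i
    reassociate = solve-∀ ℚ-ring

corollary1 : (n : ℕ) →
    (sumTo n (λ j → (ℕ→ℚ 2 ^ℚ j) * ℕ→ℚ ((3 Data.Nat.* n Data.Nat.+ 1) C (n ∸ j)))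
      ≡ ℕ→ℚ (suc n) * ℕ→ℚ ((3 Data.Nat.* n Data.Nat.+ 1) C (2 Data.Nat.* n)) * (∫[ 0ℚ , 1ℚ ] integrand n))
    × (sumTo (2 Data.Nat.* n) (λ j → ((- ℕ→ℚ 4) ^ℚ j) * ℕ→ℚ ((3 Data.Nat.* n Data.Nat.+ 1) C (n Data.Nat.+ 1 Data.Nat.+ j)))
      ≡ ½ * ℕ→ℚ (suc n) * ℕ→ℚ ((3 Data.Nat.* n Data.Nat.+ 1) C (2 Data.Nat.* n)) * (∫[ -½ , + 3 / 2 ] integrand n))
corollary1 n = first-identity n , second-identity n
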